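{- Let $n\ge1$ and let $\tau,\tau'\in\{0,1\}^n$ with $\tau\prec\tau'$, and let $d=|\lambda(\tau')|-|\lambda(\tau)|$ be the difference between the numbers of boxes of the Young diagrams $\lambda(\tau')$ and $\lambda(\tau)$. Then $f_n(\tau')-q^df_n(\tau)$ is a polynomial in $q,\alpha^{ -1},\beta^{ -1}$ with nonnegative coefficients.
   Context: Partitions and $\lambda(\tau)$: a partition $\lambda=(\lambda_1\ge\dots\ge\lambda_k\ge0)$ may have zero parts (counted); its Young diagram has $k$ left-justified rows of lengths $\lambda_1,\dots,\lambda_k$ (top to bottom). For $\tau\in\{0,1\}^n$ let $p=p_1\cdots p_{n+1}\in\{S,W\}^{n+1}$ with $p_1=S$ and $p_{i+1}=S$ iff $\tau_i=1$; if $p$ has $k$ letters $S$ and $m$ letters $W$ and the $j$-th $S$ is preceded by $w_j$ letters $W$, set $\lambda(\tau)=(m-w_1,\dots,m-w_k)$. For $\tau,\tau'\in\{0,1\}^n$ containing the same number of $1$'s (particles), write $\tau\prec\tau'$ iff the Young diagram of $\lambda(\tau)$ is contained in that of $\lambda(\tau')$. A permutation tableau of shape $\lambda$ is a $0/1$ filling of the Young diagram such that (1) every column contains at least one $1$, and (2) no $0$ has both a $1$ above it in its column and a $1$ to its left in its row. For such $\mathcal T$ with $m$ columns: $\mathrm{wt}(\mathcal T)$ = number of $1$'s minus $m$; $f(\mathcal T)$ = number of $1$'s in the top row; an entry is restricted if it is a $0$ below some $1$ in its column, a row is unrestricted if it contains no restricted entry, and $u(\mathcal T)$ = number of unrestricted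 rows minus $1$. Here $\alpha,\beta,q$ are indeterminates (general $\alpha,\beta$), and $f_n(\tau)=F_{\lambda(\tau)}(q)=\sum_{\mathcal T}q^{\mathrm{wt}(\mathcal T)}\alpha^{ -f(\mathcal T)}\beta^{ -u(\mathcal T)}$, summed over permutation tableaux of shape $\lambda(\tau)$; this is the unnormalized stationary weight of the configuration $\tau$ of the PASEP on $n$ sites. -}

module Defs where

open import Data.Bool using (Bool; true; false; not; _∧_; if_then_else_)
open import Data.Nat using (ℕ; zero; suc; _+_; _∸_; _≤_; _≤ᵇ_; _≡ᵇ_)
open import Data.List using (List; []; _∷_; length; map; concatMap; upTo)
open import Data.Bool.ListAction using (all; any)
open import Data.Nat.ListAction using (sum)
open import Data.Vec using (Vec; toList)
open import Data.Product using (_×_)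
open import Data.Unit using (⊤)
open import Relation.Binary.PropositionalEquality using (_≡_)
open import Relation.Nullary.Decidable using (does)
open import Function using (_∘_)

-- Partitions are lists of parts (top row first), zero parts allowed and
-- counted.  λ(τ) for τ ∈ {0,1}^n.

-- letters of p : true = S, false = W
word : List Bool → List Bool
word τ = true ∷ τ

numW : List Bool → ℕ
numW [] = 0
numW (true ∷ p) = numW p
numW (false ∷ p) = suc (numW p)

precW : ℕ → List Bool → List ℕ
precW w [] = []
precW w (true ∷ p) = w ∷ precW w p
precW w (false ∷ p) = precW (suc w) p

lambdaL : List Bool → List ℕ
lambdaL τ = map (λ w → numW (word τ) ∸ w) (precW 0 (word τ))

lambda : ∀ {n} → Vec Bool n → List ℕ
lambda τ = lambdaL (toList τ)

ones : List Bool → ℕ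
ones [] = 0
ones (true ∷ b) = suc (ones b)
ones (false ∷ b) = ones b

size : List ℕ → ℕ
size = sum

-- Young diagram containment (missing parts count as 0)
Contained : List ℕ → List ℕ → Set
Contained [] _ = ⊤
Contained (x ∷ xs) [] = (x ≡ 0) × Contained xs []
Contained (x ∷ xs) (y ∷ ys) = (x ≤ y) × Contained xs ys

_≺_ : ∀ {n} → Vec Bool n → Vec Bool n → Set
τ ≺ τ' = (ones (toList τ) ≡ ones (toList τ')) × Contained (lambda τ) (lambda τ')

-- Fillings of a Young diagram: list of rows (top first), row r has
-- length λ_r; true = 1, false = 0.

Filling : Set
Filling = List (List Bool)

allRows : ℕ → List (List Bool)
allRows zero = [] ∷ []
allRows (suc l) = concatMap (λ r → (true ∷ r) ∷ (false ∷ r) ∷ []) (allRows l)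

fillings : List ℕ → List Filling
fillings [] = [] ∷ []
fillings (l ∷ ls) = concatMap (λ r → map (r ∷_) (fillings ls)) (allRows l)

countB : {A : Set} → (A → Bool) → List A → ℕ
countB p [] = 0
countB p (x ∷ xs) = if p x then suc (countB p xs) else countB p xs

nthN : List ℕ → ℕ → ℕ
nthN [] _ = 0
nthN (x ∷ xs) zero = x
nthN (x ∷ xs) (suc i) = nthN xs i

nthB : List Bool → ℕ → Bool
nthB [] _ = false
nthB (x ∷ xs) zero = x
nthB (x ∷ xs) (suc i) = nthB xs i

nthR : Filling → ℕ → List Bool
nthR [] _ = []
nthR (x ∷ xs) zero = x
nthR (x ∷ xs) (suc i) = nthR xs i

-- entry in row r, column c (0-indexed); false outside the filling
entry : Filling → ℕ → ℕ → Bool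
entry T r c = nthB (nthR T r) c

module _ (sh : List ℕ) (T : Filling) where
  nrows ncols : ℕ
  nrows = length sh
  ncols = nthN sh 0

  cols : ℕ → List ℕ
  cols r = upTo (nthN sh r)

  oneAbove : ℕ → ℕ → Bool
  oneAbove r c = any (λ r' → entry T r' c) (upTo r)

  oneLeft : ℕ → ℕ → Bool
  oneLeft r c = any (λ c' → entry T r c') (upTo c)

  cond1 : Bool
  cond1 = all (λ c → any (λ r → entry T r c) (upTo nrows)) (upTo ncols)

  cond2 : Bool
  cond2 = all (λ r → all (λ c → not (not (entry T r c) ∧ oneAbove r c ∧ oneLeft r c)) (cols r)) (upTo nrows)

  isPermTableau : Bool
  isPermTableau = cond1 ∧ cond2

  numOnes : ℕ
  numOnes = sum (map (λ r → countB (λ c → entry T r c) (cols r)) (upTo nrows))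

  -- wt = (number of 1's) − (number of columns); nonnegative for tableaux by (1)
  wt : ℕ
  wt = numOnes ∸ ncols

  fstat : ℕ
  fstat = countB (λ c → entry T 0 c) (cols 0)

  restricted : ℕ → ℕ → Bool
  restricted r c = not (entry T r c) ∧ oneAbove r c

  unrestrictedRow : ℕ → Bool
  unrestrictedRow r = not (any (restricted r) (cols r))

  -- u = (number of unrestricted rows) − 1; the top row is always unrestricted
  ustat : ℕ
  ustat = countB unrestrictedRow (upTo nrows) ∸ 1

-- Polynomials in q, a = α⁻¹, b = β⁻¹ with ℕ coefficients, represented by
-- their coefficient function: P i j k = coefficient of q^i a^j b^k.

Poly3 : Set
Poly3 = ℕ → ℕ → ℕ → ℕ

F : List ℕ → Poly3
F sh i j k = countB (λ T → isPermTableau sh T ∧ (wt sh T ≡ᵇ i) ∧ (fstat sh T ≡ᵇ j) ∧ (ustat sh T ≡ᵇ k)) (fillings sh)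

f : ∀ n → Vec Bool n → Poly3
f n τ = F (lambda τ)

qPow* : ℕ → Poly3 → Poly3
qPow* d P i j k = if d ≤ᵇ i then P (i ∸ d) j k else 0

NonnegDiff : Poly3 → Poly3 → Set
NonnegDiff P Q = ∀ i j k → Q i j k ≤ P i j k

{-# OPTIONS --safe #-}
module Submission where

-- Fill the cells of λ(τ') outside λ(τ) with 1's.  This sends permutation
-- tableaux of shape λ(τ) injectively to permutation tableaux of shape
-- λ(τ'): the new 1's never create a forbidden 0 or a restricted entry, the
-- top row is unchanged because both shapes have the same number of columns,
-- and the weight grows by exactly d = |λ(τ')| − |λ(τ)|.  Hence every
-- monomial q^i α^-j β^-k of f_n(τ) reappears as q^(i+d) α^-j β^-k in f_n(τ').

open import Defs
open import Data.Bool using (Bool; true; false; not; _∧_; _∨_; T)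
open import Data.Bool.Properties using (T-∧; T-≡; ∨-assoc; ∧-assoc; ∨-identityʳ; ∧-identityʳ)
open import Data.Bool.ListAction using (all; any)
open import Data.Nat using (ℕ; zero; suc; _+_; _∸_; _≤_; _<_; _≤′_; ≤′-refl; ≤′-step; z≤n; s≤s; _≤ᵇ_; _≡ᵇ_)
open import Data.Nat.Properties
open import Data.Nat.ListAction using (sum)
open import Algebra.Properties.CommutativeSemigroup +-commutativeSemigroup using (interchange)
open import Data.Nat.ListAction.Properties using (sum-++)
open import Data.List using (List; []; _∷_; _++_; length; map; concatMap; upTo; applyUpTo; replicate)
open import Data.List.Properties
  using (map-cong; map-∘; map-++; map-applyUpTo; map-upTo; length-map; length-upTo; length-applyUpTo;
         concatMap-++; concatMap-map; map-concatMap)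
open import Data.List.Relation.Unary.All as All using (All; []; _∷_)
open import Data.List.Relation.Unary.All.Properties using (applyUpTo⁺₁; all⁺; all⁻)
open import Data.List.Relation.Unary.Any as Any using ()
open import Data.List.Relation.Unary.Any.Properties using (any⁺; any⁻)
open import Data.List.Relation.Binary.Pointwise using (Pointwise; []; _∷_; Pointwise-length)
open import Data.Vec using (Vec; toList)
open import Data.Vec.Properties using (length-toList)
open import Data.Empty using (⊥-elim)
open import Data.Product using (∃; _,_; proj₁)
open import Function using (_∘_; Equivalence)
open import Relation.Binary.PropositionalEquality

open Equivalence using (to; from)

-- Counting along lists

module _ {A : Set} where

  countB-++ : (p : A → Bool) (xs ys : List A) → countB p (xs ++ ys) ≡ countB p xs + countB p ys
  countB-++ p []       ys = refl
  countB-++ p (x ∷ xs) ys with p x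
  ... | true  = cong suc (countB-++ p xs ys)
  ... | false = countB-++ p xs ys

  any-++ : (p : A → Bool) (xs ys : List A) → any p (xs ++ ys) ≡ any p xs ∨ any p ys
  any-++ p []       ys = refl
  any-++ p (x ∷ xs) ys = trans (cong (p x ∨_) (any-++ p xs ys)) (sym (∨-assoc (p x) _ _))

  all-++ : (p : A → Bool) (xs ys : List A) → all p (xs ++ ys) ≡ all p xs ∧ all p ys
  all-++ p []       ys = refl
  all-++ p (x ∷ xs) ys = trans (cong (p x ∧_) (all-++ p xs ys)) (sym (∧-assoc (p x) _ _))

  module _ {p q : A → Bool} where

    countB-cong : ∀ {xs} → All (λ x → p x ≡ q x) xs → countB p xs ≡ countB q xs
    countB-cong [] = refl
    countB-cong (px≡qx ∷ eqs) rewrite px≡qx | countB-cong eqs = refl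

    any-cong : ∀ {xs} → All (λ x → p x ≡ q x) xs → any p xs ≡ any q xs
    any-cong []            = refl
    any-cong (px≡qx ∷ eqs) = cong₂ _∨_ px≡qx (any-cong eqs)

    all-cong : ∀ {xs} → All (λ x → p x ≡ q x) xs → all p xs ≡ all q xs
    all-cong []            = refl
    all-cong (px≡qx ∷ eqs) = cong₂ _∧_ px≡qx (all-cong eqs)

    countB-mono : ∀ {xs} → All (λ x → T (p x) → T (q x)) xs → countB p xs ≤ countB q xs
    countB-mono []                     = z≤n
    countB-mono {x ∷ _} (px⇒qx ∷ imps) with p x | q x | px⇒qx
    ... | true  | true  | _   = s≤s (countB-mono imps)
    ... | true  | false | imp = ⊥-elim (imp _)
    ... | false | true  | _   = m≤n⇒m≤1+n (countB-mono imps)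
    ... | false | false | _   = countB-mono imps

    countB-∨ : ∀ xs → countB (λ x → p x ∨ q x) xs ≤ countB p xs + countB q xs
    countB-∨ []       = z≤n
    countB-∨ (x ∷ xs) with p x | q x
    ... | true  | true  = s≤s (≤-trans (countB-∨ xs) (+-monoʳ-≤ (countB p xs) (n≤1+n _)))
    ... | true  | false = s≤s (countB-∨ xs)
    ... | false | true  rewrite +-suc (countB p xs) (countB q xs) = s≤s (countB-∨ xs)
    ... | false | false = countB-∨ xs

  module _ {p : A → Bool} where

    countB-false : ∀ {xs} → All (λ x → p x ≡ false) xs → countB p xs ≡ 0
    countB-false []           = refl
    countB-false (px≡f ∷ eqs) rewrite px≡f = countB-false eqs

    countB-true : ∀ {xs} → All (λ x → p x ≡ true) xs → countB p xs ≡ length xs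
    countB-true []           = refl
    countB-true (px≡t ∷ eqs) rewrite px≡t = cong suc (countB-true eqs)

    any-false : ∀ {xs} → All (λ x → p x ≡ false) xs → any p xs ≡ false
    any-false []           = refl
    any-false (px≡f ∷ eqs) rewrite px≡f = any-false eqs

    all-true : ∀ {xs} → All (λ x → p x ≡ true) xs → all p xs ≡ true
    all-true []           = refl
    all-true (px≡t ∷ eqs) rewrite px≡t = all-true eqs

module _ {A B : Set} where

  countB-map : (p : B → Bool) (f : A → B) (xs : List A) → countB p (map f xs) ≡ countB (p ∘ f) xs
  countB-map p f []       = refl
  countB-map p f (x ∷ xs) rewrite countB-map p f xs = refl

  countB-concatMap : (p : B → Bool) (g : A → List B) (xs : List A) →
    countB p (concatMap g xs) ≡ sum (map (countB p ∘ g) xs)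
  countB-concatMap p g []       = refl
  countB-concatMap p g (x ∷ xs) =
    trans (countB-++ p (g x) (concatMap g xs)) (cong (countB p (g x) +_) (countB-concatMap p g xs))

  countB-any-≤-sum : (rs : List B) (E : B → A → Bool) (xs : List A) →
    countB (λ x → any (λ r → E r x) rs) xs ≤ sum (map (λ r → countB (E r) xs) rs)
  countB-any-≤-sum []       E xs = ≤-reflexive (countB-false (All.universal (λ _ → refl) xs))
  countB-any-≤-sum (r ∷ rs) E xs =
    ≤-trans (countB-∨ xs) (+-monoʳ-≤ (countB (E r) xs) (countB-any-≤-sum rs E xs))

module _ {A : Set} {f g : A → ℕ} where

  sum-map-mono : ∀ {xs} → All (λ x → f x ≤ g x) xs → sum (map f xs) ≤ sum (map g xs)
  sum-map-mono []           = z≤n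
  sum-map-mono (fx≤gx ∷ hs) = +-mono-≤ fx≤gx (sum-map-mono hs)

  sum-map-+ : ∀ xs → sum (map (λ x → f x + g x) xs) ≡ sum (map f xs) + sum (map g xs)
  sum-map-+ []       = refl
  sum-map-+ (x ∷ xs) = trans (cong (f x + g x +_) (sum-map-+ xs)) (interchange (f x) (g x) (sum (map f xs)) (sum (map g xs)))

sum-++-≥ : {A : Set} (f : A → ℕ) (xs ys : List A) → sum (map f xs) ≤ sum (map f (xs ++ ys))
sum-++-≥ f xs ys = begin
  sum (map f xs)                       ≤⟨ m≤m+n _ _ ⟩
  sum (map f xs) + sum (map f ys)      ≡⟨ sum-++ (map f xs) (map f ys) ⟨
  sum (map f xs ++ map f ys)           ≡⟨ cong sum (map-++ f xs ys) ⟨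
  sum (map f (xs ++ ys))               ∎
  where open ≤-Reasoning

[m∸n]+[o∸p]≡[m+o]∸[n+p] : ∀ {m n o p} → n ≤ m → p ≤ o → (m ∸ n) + (o ∸ p) ≡ (m + o) ∸ (n + p)
[m∸n]+[o∸p]≡[m+o]∸[n+p] {m} {n} {o} {p} n≤m p≤o = begin
  (m ∸ n) + (o ∸ p)   ≡⟨ +-∸-assoc (m ∸ n) p≤o ⟨
  (m ∸ n) + o ∸ p     ≡⟨ cong (_∸ p) (+-∸-comm o n≤m) ⟨
  (m + o) ∸ n ∸ p     ≡⟨ ∸-+-assoc (m + o) n p ⟩
  (m + o) ∸ (n + p)   ∎
  where open ≡-Reasoning

-- Initial segments of ℕ

applyUpTo-+ : {A : Set} (f : ℕ → A) (m n : ℕ) →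
  applyUpTo f (m + n) ≡ applyUpTo f m ++ applyUpTo (λ i → f (m + i)) n
applyUpTo-+ f zero    n = refl
applyUpTo-+ f (suc m) n = cong (f 0 ∷_) (applyUpTo-+ (f ∘ suc) m n)

map-upTo-suc : {A : Set} (f : ℕ → A) (n : ℕ) → map f (upTo (suc n)) ≡ f 0 ∷ map (f ∘ suc) (upTo n)
map-upTo-suc f n = cong (f 0 ∷_) (trans (map-applyUpTo suc f n) (sym (map-upTo (f ∘ suc) n)))

All-upTo : {P : ℕ → Set} {n : ℕ} → (∀ {c} → c < n → P c) → All P (upTo n)
All-upTo {n = n} h = applyUpTo⁺₁ (λ c → c) n h

module _ {a b : ℕ} (a≤b : a ≤ b) where

  private
    between : List ℕ
    between = applyUpTo (a +_) (b ∸ a)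

  upTo-split : upTo b ≡ upTo a ++ between
  upTo-split = trans (cong upTo (sym (m+[n∸m]≡n a≤b))) (applyUpTo-+ (λ c → c) a (b ∸ a))

  All-between : {P : ℕ → Set} → (∀ {c} → a ≤ c → c < b → P c) → All P between
  All-between h = applyUpTo⁺₁ (a +_) (b ∸ a) (λ {i} i<b∸a →
    h (m≤m+n a i) (subst (a + i <_) (m+[n∸m]≡n a≤b) (+-monoʳ-< a i<b∸a)))

  module _ {p q : ℕ → Bool} (p≡q : ∀ {c} → c < a → p c ≡ q c) where

    countB-upTo-extend-false : (∀ {c} → a ≤ c → c < b → p c ≡ false) → countB p (upTo b) ≡ countB q (upTo a)
    countB-upTo-extend-false new = begin
      countB p (upTo b)                              ≡⟨ cong (countB p) upTo-split ⟩
      countB p (upTo a ++ between)                   ≡⟨ countB-++ p (upTo a) between ⟩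
      countB p (upTo a) + countB p between           ≡⟨ cong₂ _+_ (countB-cong (All-upTo p≡q)) (countB-false (All-between new)) ⟩
      countB q (upTo a) + 0                          ≡⟨ +-identityʳ _ ⟩
      countB q (upTo a)                              ∎
      where open ≡-Reasoning

    countB-upTo-extend-true : (∀ {c} → a ≤ c → c < b → p c ≡ true) → countB p (upTo b) ≡ countB q (upTo a) + (b ∸ a)
    countB-upTo-extend-true new = begin
      countB p (upTo b)                              ≡⟨ cong (countB p) upTo-split ⟩
      countB p (upTo a ++ between)                   ≡⟨ countB-++ p (upTo a) between ⟩
      countB p (upTo a) + countB p between           ≡⟨ cong₂ _+_ (countB-cong (All-upTo p≡q)) (countB-true (All-between new)) ⟩
      countB q (upTo a) + length between            ≡⟨ cong (countB q (upTo a) +_) (length-applyUpTo (a +_) (b ∸ a)) ⟩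
      countB q (upTo a) + (b ∸ a)                    ∎
      where open ≡-Reasoning

    any-upTo-extend : (∀ {c} → a ≤ c → c < b → p c ≡ false) → any p (upTo b) ≡ any q (upTo a)
    any-upTo-extend new = begin
      any p (upTo b)                                 ≡⟨ cong (any p) upTo-split ⟩
      any p (upTo a ++ between)                      ≡⟨ any-++ p (upTo a) between ⟩
      any p (upTo a) ∨ any p between                 ≡⟨ cong₂ _∨_ (any-cong (All-upTo p≡q)) (any-false (All-between new)) ⟩
      any q (upTo a) ∨ false                         ≡⟨ ∨-identityʳ _ ⟩
      any q (upTo a)                                 ∎
      where open ≡-Reasoning

    all-upTo-extend : (∀ {c} → a ≤ c → c < b → p c ≡ true) → all p (upTo b) ≡ all q (upTo a)
    all-upTo-extend new = begin
      all p (upTo b)                                 ≡⟨ cong (all p) upTo-split ⟩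
      all p (upTo a ++ between)                      ≡⟨ all-++ p (upTo a) between ⟩
      all p (upTo a) ∧ all p between                 ≡⟨ cong₂ _∧_ (all-cong (All-upTo p≡q)) (all-true (All-between new)) ⟩
      all q (upTo a) ∧ true                          ≡⟨ ∧-identityʳ _ ⟩
      all q (upTo a)                                 ∎
      where open ≡-Reasoning

-- Shapes and fillings

nthB-++ˡ : ∀ xs ys {c} → c < length xs → nthB (xs ++ ys) c ≡ nthB xs c
nthB-++ˡ (x ∷ xs) ys {zero}  _         = refl
nthB-++ˡ (x ∷ xs) ys {suc c} (s≤s c<n) = nthB-++ˡ xs ys c<n

nthB-++ʳ : ∀ xs ys {c} → length xs ≤ c → nthB (xs ++ ys) c ≡ nthB ys (c ∸ length xs)
nthB-++ʳ []       ys         _         = refl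
nthB-++ʳ (x ∷ xs) ys {suc c} (s≤s n≤c) = nthB-++ʳ xs ys n≤c

nthB-++⁺ : ∀ xs ys {c} → T (nthB xs c) → T (nthB (xs ++ ys) c)
nthB-++⁺ (x ∷ xs) ys {zero}  t = t
nthB-++⁺ (x ∷ xs) ys {suc c} t = nthB-++⁺ xs ys t

nthB-replicate-true : ∀ {n c} → c < n → nthB (replicate n true) c ≡ true
nthB-replicate-true {suc n} {zero}  _         = refl
nthB-replicate-true {suc n} {suc c} (s≤s c<n) = nthB-replicate-true c<n

nthB-≥length : ∀ xs {c} → length xs ≤ c → nthB xs c ≡ false
nthB-≥length []                 _         = refl
nthB-≥length (x ∷ xs) {suc c} (s≤s n≤c) = nthB-≥length xs n≤c

nthN-mono : ∀ {sh sh'} → Pointwise _≤_ sh sh' → ∀ r → nthN sh r ≤ nthN sh' r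
nthN-mono []            r       = z≤n
nthN-mono (l≤l' ∷ _)    zero    = l≤l'
nthN-mono (_ ∷ ls≤ls')  (suc r) = nthN-mono ls≤ls' r

HasShape : List ℕ → Filling → Set
HasShape = Pointwise (λ l row → length row ≡ l)

length-nthR : ∀ {sh X} → HasShape sh X → ∀ r → length (nthR X r) ≡ nthN sh r
length-nthR []               r       = refl
length-nthR (len ∷ _)        zero    = len
length-nthR (_ ∷ X-shape)    (suc r) = length-nthR X-shape r

entry-outside : ∀ {sh X} → HasShape sh X → ∀ {r c} → nthN sh r ≤ c → entry X r c ≡ false
entry-outside {X = X} X-shape {r} l≤c = nthB-≥length (nthR X r) (≤-trans (≤-reflexive (length-nthR X-shape r)) l≤c)

extendByOnes : List ℕ → List ℕ → Filling → Filling
extendByOnes (l ∷ ls) (l' ∷ ls') (row ∷ X) = (row ++ replicate (l' ∸ l) true) ∷ extendByOnes ls ls' X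
extendByOnes _        _          X         = X

nthR-extendByOnes : ∀ {sh sh' X} → Pointwise _≤_ sh sh' → HasShape sh X → ∀ r →
  nthR (extendByOnes sh sh' X) r ≡ nthR X r ++ replicate (nthN sh' r ∸ nthN sh r) true
nthR-extendByOnes []             []              r       = refl
nthR-extendByOnes (_ ∷ _)        (_ ∷ _)         zero    = refl
nthR-extendByOnes (_ ∷ ls≤ls')   (_ ∷ X-shape)   (suc r) = nthR-extendByOnes ls≤ls' X-shape r

size-mono : ∀ {sh sh'} → Pointwise _≤_ sh sh' → size sh ≤ size sh'
size-mono []              = z≤n
size-mono (l≤l' ∷ ls≤ls') = +-mono-≤ l≤l' (size-mono ls≤ls')

sum-gaps : ∀ {sh sh'} → Pointwise _≤_ sh sh' →
  sum (map (λ r → nthN sh' r ∸ nthN sh r) (upTo (length sh))) ≡ size sh' ∸ size sh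
sum-gaps []                                       = refl
sum-gaps {l ∷ ls} {l' ∷ ls'} (l≤l' ∷ ls≤ls') = begin
  sum (map gap (upTo (suc (length ls))))
    ≡⟨ cong sum (map-upTo-suc gap (length ls)) ⟩
  (l' ∸ l) + sum (map (λ r → nthN ls' r ∸ nthN ls r) (upTo (length ls)))
    ≡⟨ cong ((l' ∸ l) +_) (sum-gaps ls≤ls') ⟩
  (l' ∸ l) + (size ls' ∸ size ls)
    ≡⟨ [m∸n]+[o∸p]≡[m+o]∸[n+p] l≤l' (size-mono ls≤ls') ⟩
  size (l' ∷ ls') ∸ size (l ∷ ls) ∎
  where
    open ≡-Reasoning
    gap : ℕ → ℕ
    gap r = nthN (l' ∷ ls') r ∸ nthN (l ∷ ls) r

prependBit : List Bool → List (List Bool)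
prependBit row = (true ∷ row) ∷ (false ∷ row) ∷ []

allRows-length : ∀ l → All (λ row → length row ≡ l) (allRows l)
allRows-length zero    = refl ∷ []
allRows-length (suc l) = go (allRows-length l)
  where
    go : ∀ {rows} → All (λ row → length row ≡ l) rows → All (λ row → length row ≡ suc l) (concatMap prependBit rows)
    go []           = []
    go (len ∷ lens) = cong suc len ∷ cong suc len ∷ go lens

allRows-head : ∀ e → ∃ λ R → allRows e ≡ replicate e true ∷ R
allRows-head zero    = [] , refl
allRows-head (suc e) with allRows-head e
... | R , eq = _ , cong (concatMap prependBit) eq

allRows-+ : ∀ l e → ∃ λ R → allRows (l + e) ≡ map (_++ replicate e true) (allRows l) ++ R
allRows-+ zero    e = allRows-head e
allRows-+ (suc l) e with allRows-+ l e
... | R , eq = concatMap prependBit R , (begin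
  concatMap prependBit (allRows (l + e))                         ≡⟨ cong (concatMap prependBit) eq ⟩
  concatMap prependBit (map pad (allRows l) ++ R)                ≡⟨ concatMap-++ prependBit (map pad (allRows l)) R ⟩
  concatMap prependBit (map pad (allRows l)) ++ concatMap prependBit R
    ≡⟨ cong (_++ concatMap prependBit R) (concatMap-map prependBit pad (allRows l)) ⟩
  concatMap (map pad ∘ prependBit) (allRows l) ++ concatMap prependBit R
    ≡⟨ cong (_++ concatMap prependBit R) (map-concatMap pad prependBit (allRows l)) ⟨
  map pad (concatMap prependBit (allRows l)) ++ concatMap prependBit R ∎)
  where
    open ≡-Reasoning
    pad : List Bool → List Bool
    pad row = row ++ replicate e true

allRows-padded-prefix : ∀ {l l'} → l ≤ l' →
  ∃ λ R → allRows l' ≡ map (_++ replicate (l' ∸ l) true) (allRows l) ++ R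
allRows-padded-prefix {l} {l'} l≤l' =
  subst (λ m → ∃ λ R → allRows m ≡ map (_++ replicate (l' ∸ l) true) (allRows l) ++ R)
        (m+[n∸m]≡n l≤l') (allRows-+ l (l' ∸ l))

-- Padding is never shown injective: by allRows-padded-prefix, the padded
-- enumeration of fillings of sh is a sub-enumeration of that of sh'.
countB-fillings-extend : ∀ {sh sh'} → Pointwise _≤_ sh sh' → (P Q : Filling → Bool) →
  (∀ {X} → HasShape sh X → T (P X) → T (Q (extendByOnes sh sh' X))) →
  countB P (fillings sh) ≤ countB Q (fillings sh')
countB-fillings-extend [] P Q preserves = countB-mono {p = P} {q = Q} (preserves [] ∷ [])
countB-fillings-extend {l ∷ ls} {l' ∷ ls'} (l≤l' ∷ ls≤ls') P Q preserves
  with allRows-padded-prefix l≤l'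
... | R , allRows-l' = begin
  countB P (fillings (l ∷ ls))                                 ≡⟨ countB-concatMap P (withRow ls) (allRows l) ⟩
  sum (map (countB P ∘ withRow ls) (allRows l))                ≤⟨ sum-map-mono (All.map row-step (allRows-length l)) ⟩
  sum (map (countB Q ∘ withRow ls' ∘ pad) (allRows l))         ≡⟨ cong sum (map-∘ (allRows l)) ⟩
  sum (map (countB Q ∘ withRow ls') (map pad (allRows l)))     ≤⟨ sum-++-≥ (countB Q ∘ withRow ls') (map pad (allRows l)) R ⟩
  sum (map (countB Q ∘ withRow ls') (map pad (allRows l) ++ R)) ≡⟨ cong (sum ∘ map (countB Q ∘ withRow ls')) allRows-l' ⟨
  sum (map (countB Q ∘ withRow ls') (allRows l'))              ≡⟨ countB-concatMap Q (withRow ls') (allRows l') ⟨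
  countB Q (fillings (l' ∷ ls'))                               ∎
  where
    open ≤-Reasoning
    withRow : List ℕ → List Bool → List Filling
    withRow ms row = map (row ∷_) (fillings ms)
    pad : List Bool → List Bool
    pad row = row ++ replicate (l' ∸ l) true
    row-step : ∀ {row} → length row ≡ l → countB P (withRow ls row) ≤ countB Q (withRow ls' (pad row))
    row-step {row} len = begin
      countB P (withRow ls row)                 ≡⟨ countB-map P (row ∷_) (fillings ls) ⟩
      countB (P ∘ (row ∷_)) (fillings ls)       ≤⟨ countB-fillings-extend ls≤ls' (P ∘ (row ∷_)) (Q ∘ (pad row ∷_))
                                                     (λ X-shape → preserves (len ∷ X-shape)) ⟩
      countB (Q ∘ (pad row ∷_)) (fillings ls')  ≡⟨ countB-map Q (pad row ∷_) (fillings ls') ⟨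
      countB Q (withRow ls' (pad row))          ∎

-- Permutation tableaux

Nonincreasing : List ℕ → Set
Nonincreasing sh = ∀ {i j} → i ≤ j → nthN sh j ≤ nthN sh i

antitone-stepwise : (g : ℕ → ℕ) → (∀ i → g (suc i) ≤ g i) → ∀ {i j} → i ≤ j → g j ≤ g i
antitone-stepwise g step i≤j = go (≤⇒≤′ i≤j)
  where
    go : ∀ {i j} → i ≤′ j → g j ≤ g i
    go ≤′-refl          = ≤-refl
    go (≤′-step i≤′j)   = ≤-trans (step _) (go i≤′j)

ncols≤numOnes : ∀ {sh X} → Nonincreasing sh → HasShape sh X → T (cond1 sh X) → ncols sh X ≤ numOnes sh X
ncols≤numOnes {sh} {X} sh-dec X-shape covered = begin
  nthN sh 0
    ≡⟨ length-upTo (nthN sh 0) ⟨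
  length (upTo (nthN sh 0))
    ≡⟨ countB-true (All.map (to T-≡) (all⁺ column-hit (upTo (nthN sh 0)) covered)) ⟨
  countB column-hit (upTo (nthN sh 0))
    ≤⟨ countB-any-≤-sum (upTo (length sh)) (entry X) (upTo (nthN sh 0)) ⟩
  sum (map (λ r → countB (entry X r) (upTo (nthN sh 0))) (upTo (length sh)))
    ≡⟨ cong sum (map-cong row-restrict (upTo (length sh))) ⟩
  numOnes sh X ∎
  where
    open ≤-Reasoning
    column-hit : ℕ → Bool
    column-hit c = any (λ r → entry X r c) (upTo (length sh))
    row-restrict : ∀ r → countB (entry X r) (upTo (nthN sh 0)) ≡ countB (entry X r) (upTo (nthN sh r))
    row-restrict r = countB-upTo-extend-false (sh-dec z≤n) (λ _ → refl) (λ l≤c _ → entry-outside X-shape l≤c)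

cond2At : List ℕ → Filling → ℕ → ℕ → Bool
cond2At sh X r c = not (not (entry X r c) ∧ oneAbove sh X r c ∧ oneLeft sh X r c)

module Padding {sh sh' : List ℕ} (sh≤sh' : Pointwise _≤_ sh sh') (sh-dec : Nonincreasing sh)
               (same-ncols : nthN sh 0 ≡ nthN sh' 0) {X : Filling} (X-shape : HasShape sh X) where

  X' : Filling
  X' = extendByOnes sh sh' X

  same-nrows : length sh ≡ length sh'
  same-nrows = Pointwise-length sh≤sh'

  gap : ℕ → ℕ
  gap r = nthN sh' r ∸ nthN sh r

  entry-extend : ∀ r c → entry X' r c ≡ nthB (nthR X r ++ replicate (gap r) true) c
  entry-extend r c = cong (λ row → nthB row c) (nthR-extendByOnes sh≤sh' X-shape r)

  entry-old : ∀ {r c} → c < nthN sh r → entry X' r c ≡ entry X r c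
  entry-old {r} {c} c<l =
    trans (entry-extend r c) (nthB-++ˡ (nthR X r) _ (subst (c <_) (sym (length-nthR X-shape r)) c<l))

  entry-new : ∀ {r c} → nthN sh r ≤ c → c < nthN sh' r → entry X' r c ≡ true
  entry-new {r} {c} l≤c c<l' = begin
    entry X' r c
      ≡⟨ entry-extend r c ⟩
    nthB (nthR X r ++ replicate (gap r) true) c
      ≡⟨ nthB-++ʳ (nthR X r) _ (≤-trans (≤-reflexive len) l≤c) ⟩
    nthB (replicate (gap r) true) (c ∸ length (nthR X r))
      ≡⟨ nthB-replicate-true (subst (λ l → c ∸ l < gap r) (sym len) (∸-monoˡ-< c<l' l≤c)) ⟩
    true ∎
    where
      open ≡-Reasoning
      len : length (nthR X r) ≡ nthN sh r
      len = length-nthR X-shape r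

  entry-mono : ∀ r c → T (entry X r c) → T (entry X' r c)
  entry-mono r c t = subst T (sym (entry-extend r c)) (nthB-++⁺ (nthR X r) _ t)

  oneAbove-extend : ∀ {r c} → c < nthN sh r → oneAbove sh' X' r c ≡ oneAbove sh X r c
  oneAbove-extend c<l = any-cong (All-upTo (λ r'<r → entry-old (<-≤-trans c<l (sh-dec (<⇒≤ r'<r)))))

  oneLeft-extend : ∀ {r c} → c < nthN sh r → oneLeft sh' X' r c ≡ oneLeft sh X r c
  oneLeft-extend c<l = any-cong (All-upTo (λ c'<c → entry-old (<-trans c'<c c<l)))

  cond1-extend : T (cond1 sh X) → T (cond1 sh' X')
  cond1-extend covered =
    subst₂ (λ m k → T (all (λ c → any (λ r → entry X' r c) (upTo m)) (upTo k))) same-nrows same-ncols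
      (all⁻ (column-hit X') (All.map column-hit-mono (all⁺ (column-hit X) (upTo (nthN sh 0)) covered)))
    where
      column-hit : Filling → ℕ → Bool
      column-hit Y c = any (λ r → entry Y r c) (upTo (length sh))
      column-hit-mono : ∀ {c} → T (column-hit X c) → T (column-hit X' c)
      column-hit-mono {c} =
        any⁺ (λ r → entry X' r c) ∘ Any.map (entry-mono _ c) ∘ any⁻ (λ r → entry X r c) (upTo (length sh))

  cond2-row-extend : ∀ r → all (cond2At sh' X' r) (upTo (nthN sh' r)) ≡ all (cond2At sh X r) (upTo (nthN sh r))
  cond2-row-extend r = all-upTo-extend (nthN-mono sh≤sh' r)
    (λ c<l → cong₂ (λ e ab → not (not e ∧ ab)) (entry-old c<l) (cong₂ _∧_ (oneAbove-extend c<l) (oneLeft-extend c<l)))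
    (λ {c} l≤c c<l' → cong (λ e → not (not e ∧ oneAbove sh' X' r c ∧ oneLeft sh' X' r c)) (entry-new l≤c c<l'))

  cond2-extend : cond2 sh' X' ≡ cond2 sh X
  cond2-extend = trans (cong (λ m → all (λ r → all (cond2At sh' X' r) (upTo (nthN sh' r))) (upTo m)) (sym same-nrows))
                       (all-cong (All.universal cond2-row-extend (upTo (length sh))))

  isPermTableau-extend : T (isPermTableau sh X) → T (isPermTableau sh' X')
  isPermTableau-extend t = let c1 , c2 = to (T-∧ {cond1 sh X}) t in
    from T-∧ (cond1-extend c1 , subst T (sym cond2-extend) c2)

  fstat-extend : fstat sh' X' ≡ fstat sh X
  fstat-extend = trans (cong (λ m → countB (entry X' 0) (upTo m)) (sym same-ncols)) (countB-cong (All-upTo entry-old))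

  unrestrictedRow-extend : ∀ r → unrestrictedRow sh' X' r ≡ unrestrictedRow sh X r
  unrestrictedRow-extend r = cong not (any-upTo-extend (nthN-mono sh≤sh' r)
    (λ c<l → cong₂ (λ e a → not e ∧ a) (entry-old c<l) (oneAbove-extend c<l))
    (λ {c} l≤c c<l' → cong (λ e → not e ∧ oneAbove sh' X' r c) (entry-new l≤c c<l')))

  ustat-extend : ustat sh' X' ≡ ustat sh X
  ustat-extend = trans (cong (λ m → countB (unrestrictedRow sh' X') (upTo m) ∸ 1) (sym same-nrows))
                       (cong (_∸ 1) (countB-cong (All.universal unrestrictedRow-extend (upTo (length sh)))))

  rowOnes-extend : ∀ r → countB (entry X' r) (upTo (nthN sh' r)) ≡ countB (entry X r) (upTo (nthN sh r)) + gap r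
  rowOnes-extend r = countB-upTo-extend-true (nthN-mono sh≤sh' r) entry-old entry-new

  numOnes-extend : numOnes sh' X' ≡ numOnes sh X + (size sh' ∸ size sh)
  numOnes-extend = begin
    sum (map (λ r → countB (entry X' r) (upTo (nthN sh' r))) (upTo (length sh')))
      ≡⟨ cong (λ m → sum (map (λ r → countB (entry X' r) (upTo (nthN sh' r))) (upTo m))) same-nrows ⟨
    sum (map (λ r → countB (entry X' r) (upTo (nthN sh' r))) (upTo (length sh)))
      ≡⟨ cong sum (map-cong rowOnes-extend (upTo (length sh))) ⟩
    sum (map (λ r → countB (entry X r) (upTo (nthN sh r)) + gap r) (upTo (length sh)))
      ≡⟨ sum-map-+ (upTo (length sh)) ⟩
    numOnes sh X + sum (map gap (upTo (length sh)))
      ≡⟨ cong (numOnes sh X +_) (sum-gaps sh≤sh') ⟩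
    numOnes sh X + (size sh' ∸ size sh) ∎
    where open ≡-Reasoning

  -- wt is a truncated difference; cond1 gives ncols ≤ numOnes, so adding d commutes with it.
  wt-extend : T (cond1 sh X) → wt sh' X' ≡ wt sh X + (size sh' ∸ size sh)
  wt-extend covered = begin
    numOnes sh' X' ∸ nthN sh' 0                        ≡⟨ cong₂ _∸_ numOnes-extend (sym same-ncols) ⟩
    numOnes sh X + (size sh' ∸ size sh) ∸ nthN sh 0    ≡⟨ +-∸-comm _ (ncols≤numOnes sh-dec X-shape covered) ⟩
    wt sh X + (size sh' ∸ size sh)                     ∎
    where open ≡-Reasoning

F-extend-≤ : ∀ {sh sh'} → Pointwise _≤_ sh sh' → Nonincreasing sh → nthN sh 0 ≡ nthN sh' 0 →
  ∀ i j k → F sh i j k ≤ F sh' (i + (size sh' ∸ size sh)) j k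
F-extend-≤ {sh} {sh'} sh≤sh' sh-dec same-ncols i j k =
  countB-fillings-extend sh≤sh' (counted sh i) (counted sh' (i + d)) preserves
  where
    d : ℕ
    d = size sh' ∸ size sh
    counted : List ℕ → ℕ → Filling → Bool
    counted s w Y = isPermTableau s Y ∧ (wt s Y ≡ᵇ w) ∧ (fstat s Y ≡ᵇ j) ∧ (ustat s Y ≡ᵇ k)
    preserves : ∀ {X} → HasShape sh X → T (counted sh i X) → T (counted sh' (i + d) (extendByOnes sh sh' X))
    preserves {X} X-shape t =
      let perm , t₁ = to (T-∧ {isPermTableau sh X}) t
          w , t₂    = to (T-∧ {wt sh X ≡ᵇ i}) t₁
          fs , us   = to (T-∧ {fstat sh X ≡ᵇ j}) t₂
          wt≡i+d    = trans (wt-extend (proj₁ (to (T-∧ {cond1 sh X}) perm))) (cong (_+ d) (≡ᵇ⇒≡ _ _ w))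
      in from T-∧ (isPermTableau-extend perm , from T-∧ (≡⇒≡ᵇ _ _ wt≡i+d ,
           from T-∧ (subst (λ v → T (v ≡ᵇ j)) (sym fstat-extend) fs , subst (λ v → T (v ≡ᵇ k)) (sym ustat-extend) us)))
      where open Padding sh≤sh' sh-dec same-ncols X-shape

-- The shape λ(τ)

numW+ones≡length : ∀ p → numW p + ones p ≡ length p
numW+ones≡length []          = refl
numW+ones≡length (true ∷ p)  = trans (+-suc (numW p) (ones p)) (cong suc (numW+ones≡length p))
numW+ones≡length (false ∷ p) = cong suc (numW+ones≡length p)

length-precW : ∀ w p → length (precW w p) ≡ ones p
length-precW w []          = refl
length-precW w (true ∷ p)  = cong suc (length-precW w p)
length-precW w (false ∷ p) = length-precW (suc w) p

length-lambdaL : ∀ p → length (lambdaL p) ≡ suc (ones p)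
length-lambdaL p = trans (length-map _ (precW 0 (true ∷ p))) (length-precW 0 (true ∷ p))

parts : ℕ → ℕ → List Bool → List ℕ
parts m w p = map (m ∸_) (precW w p)

head-parts-≤ : ∀ m w p → nthN (parts m w p) 0 ≤ m ∸ w
head-parts-≤ m w []          = z≤n
head-parts-≤ m w (true ∷ p)  = ≤-refl
head-parts-≤ m w (false ∷ p) = ≤-trans (head-parts-≤ m (suc w) p) (∸-monoʳ-≤ m (n≤1+n w))

parts-step : ∀ m w p i → nthN (parts m w p) (suc i) ≤ nthN (parts m w p) i
parts-step m w []          i       = z≤n
parts-step m w (true ∷ p)  zero    = head-parts-≤ m w p
parts-step m w (true ∷ p)  (suc i) = parts-step m w p i
parts-step m w (false ∷ p) i       = parts-step m (suc w) p i

lambdaL-nonincreasing : ∀ p → Nonincreasing (lambdaL p)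
lambdaL-nonincreasing p = antitone-stepwise (nthN (lambdaL p)) (parts-step (numW p) 0 (true ∷ p))

Contained⇒Pointwise : ∀ {xs ys} → length xs ≡ length ys → Contained xs ys → Pointwise _≤_ xs ys
Contained⇒Pointwise {[]}     {[]}     _   _              = []
Contained⇒Pointwise {x ∷ xs} {y ∷ ys} len (x≤y , xs⊆ys) = x≤y ∷ Contained⇒Pointwise (suc-injective len) xs⊆ys

lambdaL-Pointwise : ∀ p p' → ones p ≡ ones p' → Contained (lambdaL p) (lambdaL p') → Pointwise _≤_ (lambdaL p) (lambdaL p')
lambdaL-Pointwise p p' same-ones =
  Contained⇒Pointwise (trans (length-lambdaL p) (trans (cong suc same-ones) (sym (length-lambdaL p'))))

numW-determined : ∀ p p' → length p ≡ length p' → ones p ≡ ones p' → numW p ≡ numW p'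
numW-determined p p' same-length same-ones = +-cancelʳ-≡ (ones p) (numW p) (numW p') (begin
  numW p + ones p    ≡⟨ numW+ones≡length p ⟩
  length p           ≡⟨ same-length ⟩
  length p'          ≡⟨ numW+ones≡length p' ⟨
  numW p' + ones p'  ≡⟨ cong (numW p' +_) same-ones ⟨
  numW p' + ones p   ∎)
  where open ≡-Reasoning

qPow*-≤ : ∀ d (P Q : Poly3) → (∀ i j k → P i j k ≤ Q (i + d) j k) → NonnegDiff Q (qPow* d P)
qPow*-≤ d P Q P≤Q i j k with d ≤ᵇ i in d≤ᵇi
... | false = z≤n
... | true  = subst (λ m → P (i ∸ d) j k ≤ Q m j k) (m∸n+n≡m (≤ᵇ⇒≤ d i (from T-≡ d≤ᵇi))) (P≤Q (i ∸ d) j k)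

proposition5p2 : (n : ℕ) → 1 ≤ n → (τ τ' : Vec Bool n) → τ ≺ τ' →
    NonnegDiff (f n τ') (qPow* (size (lambda τ') ∸ size (lambda τ)) (f n τ))
proposition5p2 n _ τ τ' (same-ones , λ⊆λ') =
  qPow*-≤ _ (F (lambda τ)) (F (lambda τ')) (F-extend-≤ λ≤λ' (lambdaL-nonincreasing p) same-ncols)
  where
    p p' : List Bool
    p  = toList τ
    p' = toList τ'
    λ≤λ' : Pointwise _≤_ (lambda τ) (lambda τ')
    λ≤λ' = lambdaL-Pointwise p p' same-ones λ⊆λ'
    -- the first part of λ(τ) is m − w₁ = m, the number of W's
    same-ncols : numW p ≡ numW p'
    same-ncols = numW-determined p p' (trans (length-toList τ) (sym (length-toList τ'))) same-ones
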